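{- Let $\lambda$ be a cardinal, let $\mathcal F$ and $\mathcal H$ be families of subsets of some ordinal with $(\mathcal F,\subseteq^*)$ $\lambda$-directed, and let $p\in\mathcal R(\mathcal F,\mathcal H)$. Then for every $A\subseteq\mathcal F$ with $|A|<\lambda$ there exists $y\in\mathcal F$ such that $x_p\subseteq y$ and $a\subseteq^* y$ for all $a\in A$.
   Context: $x\subseteq^* y$ means $x\setminus y$ is finite. $(\mathcal F,\subseteq^*)$ is $\lambda$-directed if every subset of $\mathcal F$ of cardinality less than $\lambda$ has a $\subseteq^*$-upper bound in $\mathcal F$. A subset $X\subseteq\mathcal F$ is cofinal in $(\mathcal F,\subseteq^*)$ if every $z\in\mathcal F$ has some $y\in X$ with $z\subseteq^* y$. $\mathcal R(\mathcal F,\mathcal H)$ is the poset of pairs $p=(x_p,\mathcal X_p)$ where $x_p\in\mathcal H$, $\mathcal X_p$ is a nonempty countable family of cofinal subsets of $(\mathcal F,\subseteq^*)$, and for every $X\in\mathcal X_p$ the set $\{y\in X: x_p\subseteq y\}$ is cofinal in $(\mathcal F,\subseteq^*)$; $q$ extends $p$ iff $x_q$ end-extends $x_p$ (i.e. $x_p$ is an initial segment of $x_q$ in the ordinal order) and $\mathcal X_q\supseteq\mathcal X_p$. -}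

module Defs where

open import Level using (Level; 0ℓ) renaming (suc to lsuc)
open import Data.Nat using (ℕ)
open import Data.List using (List)
open import Data.List.Membership.Propositional using (_∈_)
open import Data.Product using (Σ; ∃; _×_; _,_)
open import Data.Sum using (_⊎_)
open import Relation.Nullary using (¬_)
open import Relation.Binary using (Rel; IsStrictTotalOrder)
open import Relation.Binary.PropositionalEquality using (_≡_)
open import Induction.WellFounded using (WellFounded)
open import Function.Bundles using (_↣_)

record Ordinal : Set₁ where
  field
    Carrier   : Set
    _<_       : Rel Carrier 0ℓ
    isSTO     : IsStrictTotalOrder _≡_ _<_
    wf        : WellFounded _<_

module _ (α : Ordinal) where
  open Ordinal α

  Subset : Set₁
  Subset = Carrier → Set

  Family : Set₂
  Family = Subset → Set₁

  _⊆_ : Subset → Subset → Set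
  x ⊆ y = ∀ i → x i → y i

  -- x ⊆* y : x ∖ y is finite, i.e. x ∖ y is contained in a finite list
  _⊆*_ : Subset → Subset → Set
  x ⊆* y = Σ (List Carrier) λ l → ∀ i → x i → y i ⊎ i ∈ l

  EndExtends : Subset → Subset → Set
  EndExtends x xp = xp ⊆ x × (∀ i j → xp i → x j → j < i → xp j)

  -- |A| < |L| : A injects into L, but L does not inject into A
  _≺_ : Set₁ → Set₁ → Set₁
  A ≺ L = (A ↣ L) × ¬ (L ↣ A)

  Directed : (λ' : Set₁) → Family → Set₂
  Directed λ' 𝓕 = (A : Family) → (∀ a → A a → 𝓕 a) → Σ Subset A ≺ λ' →
                  Σ Subset λ z → 𝓕 z × (∀ a → A a → a ⊆* z)

  Cofinal : Family → Family → Set₁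
  Cofinal 𝓕 X = (∀ y → X y → 𝓕 y) ×
                (∀ z → 𝓕 z → Σ Subset λ y → X y × z ⊆* y)

  CofinalAbove : Family → Subset → Family → Set₁
  CofinalAbove 𝓕 x X = Cofinal 𝓕 (λ y → X y × x ⊆ y)

  -- Conditions of 𝓡(𝓕, 𝓗).  The nonempty countable family 𝒳_p is given by an
  -- enumeration ℕ → Family (its members are exactly the values 𝒳 n).
  record R (𝓕 𝓗 : Family) : Set₂ where
    field
      x       : Subset
      x∈𝓗     : 𝓗 x
      𝒳       : ℕ → Family
      cofinal : ∀ n → Cofinal 𝓕 (𝒳 n)
      above   : ∀ n → CofinalAbove 𝓕 x (𝒳 n)

  _∈𝒳_ : {𝓕 𝓗 : Family} → Family → R 𝓕 𝓗 → Set₂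
  X ∈𝒳 p = ∃ λ n → R.𝒳 p n ≡ X

  _≤R_ : {𝓕 𝓗 : Family} → R 𝓕 𝓗 → R 𝓕 𝓗 → Set₂
  q ≤R p = EndExtends (R.x q) (R.x p) × (∀ X → X ∈𝒳 p → X ∈𝒳 q)

-- Directedness gives an upper bound z ∈ 𝓕 of A.  Any member
-- X of 𝒳_p (e.g. the first one in the enumeration) has the property that
-- {y ∈ X : x_p ⊆ y} is cofinal in (𝓕, ⊆*), so some y ∈ X ⊆ 𝓕 with x_p ⊆ y
-- satisfies z ⊆* y.  Transitivity of ⊆* then makes y an upper bound of A.
module Submission where

open import Defs
open import Data.Product using (Σ; _×_; _,_; proj₁; proj₂)
open import Data.Sum using (_⊎_; inj₁; inj₂)
open import Data.List.Membership.Propositional using (_∈_)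
open import Data.Nat using (zero)
open import Data.List using (_++_)
open import Data.List.Membership.Propositional.Properties using (∈-++⁺ˡ; ∈-++⁺ʳ)

module _ (α : Ordinal) where
  open Ordinal α using (Carrier)

  ⊆*-trans : ∀ {a z y} → _⊆*_ α a z → _⊆*_ α z y → _⊆*_ α a y
  ⊆*-trans {a} {z} {y} (l₁ , a∖z⊆l₁) (l₂ , z∖y⊆l₂) = l₁ ++ l₂ , a∖y⊆l₁++l₂
    where
    a∖y⊆l₁++l₂ : ∀ i → a i → y i ⊎ i ∈ l₁ ++ l₂
    a∖y⊆l₁++l₂ i ai with a∖z⊆l₁ i ai
    ... | inj₂ i∈l₁ = inj₂ (∈-++⁺ˡ i∈l₁)
    ... | inj₁ zi with z∖y⊆l₂ i zi
    ...   | inj₁ yi   = inj₁ yi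
    ...   | inj₂ i∈l₂ = inj₂ (∈-++⁺ʳ l₁ i∈l₂)

  dominateAbove : (𝓕 X : Family α) (x : Subset α) → CofinalAbove α 𝓕 x X →
    ∀ z → 𝓕 z → Σ (Subset α) λ y → 𝓕 y × _⊆_ α x y × _⊆*_ α z y
  dominateAbove 𝓕 X x (cofinal⊆𝓕 , cofinal) z z∈𝓕
    with cofinal z z∈𝓕
  ... | y , y∈X×x⊆y@(_ , x⊆y) , z⊆*y = y , cofinal⊆𝓕 y y∈X×x⊆y , x⊆y , z⊆*y

proposition3p3 : (α : Ordinal) (λ' : Set₁) (𝓕 𝓗 : Family α) →
    Directed α λ' 𝓕 → (p : R α 𝓕 𝓗) →
    (A : Family α) → (∀ a → A a → 𝓕 a) → _≺_ α (Σ (Subset α) A) λ' →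
    Σ (Subset α) λ y → 𝓕 y × _⊆_ α (R.x p) y × (∀ a → A a → _⊆*_ α a y)
proposition3p3 α λ' 𝓕 𝓗 directed p A A⊆𝓕 A≺λ
  with directed A A⊆𝓕 A≺λ
... | z , z∈𝓕 , A≤*z
  with dominateAbove α 𝓕 (R.𝒳 p zero) (R.x p) (R.above p zero) z z∈𝓕
... | y , y∈𝓕 , xp⊆y , z⊆*y =
  y , y∈𝓕 , xp⊆y , λ a a∈A → ⊆*-trans α (A≤*z a a∈A) z⊆*y
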